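{- Let $G$ be a graph with at least one edge such that every maximal clique of $G$ has an edge occupied by it. Then $k(G)=\theta_e(G)-|V(G)|+p(G)$.
   Context: All graphs are finite and simple; digraphs are finite, without loops or multiple arcs. A clique is a vertex set inducing a complete subgraph; it covers an edge if it contains both ends. For a maximal clique $C$ of $G$, an edge is occupied by $C$ if $C$ is the only maximal clique of $G$ covering it. The competition graph $C(D)$ of a digraph $D$ has vertex set $V(D)$, and distinct $x,y$ are adjacent iff some $z$ has arcs $(x,z),(y,z)$ in $D$. The competition number $k(G)$ is the smallest $k\ge0$ such that $G$ together with $k$ new isolated vertices is the competition graph of an acyclic digraph. The primary predator index $p(G)$ is the maximum, over all acyclic digraphs $D$ whose competition graph is $G$ together with $k(G)$ isolated vertices, of the number of in-degree-$0$ vertices of $D$. $\theta_e(G)$ is the minimum number of cliques covering all edges of $G$. -}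

module Defs where

open import Data.Nat using (ℕ; _+_; _≤_)
open import Data.Fin using (Fin; splitAt)
open import Data.Fin.Subset using (Subset; _∈_; _⊆_)
open import Data.Fin.Properties using (all?)
open import Data.Bool using (Bool; true; false; T; _≟_)
open import Data.Sum using (inj₁; inj₂)
open import Data.Product using (Σ; ∃; ∃-syntax; _×_)
open import Data.List using (List; length; filter; allFin)
open import Relation.Nullary using (¬_)
open import Relation.Binary.PropositionalEquality using (_≡_; _≢_)
open import Relation.Binary.Construct.Closure.Transitive using (TransClosure)
open import Function.Bundles using (_⇔_)

record Graph (n : ℕ) : Set where
  field
    adj     : Fin n → Fin n → Bool
    sym     : ∀ x y → adj x y ≡ adj y x
    irrefl  : ∀ x → adj x x ≡ false
open Graph public

record Digraph (m : ℕ) : Set where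
  field
    arc    : Fin m → Fin m → Bool
    noLoop : ∀ x → arc x x ≡ false
open Digraph public

Arc : ∀ {m} → Digraph m → Fin m → Fin m → Set
Arc D x y = T (arc D x y)

Acyclic : ∀ {m} → Digraph m → Set
Acyclic D = ∀ x → ¬ TransClosure (Arc D) x x

Edge : ∀ {n} → Graph n → Fin n → Fin n → Set
Edge G x y = T (adj G x y)

-- G together with k new isolated vertices (the new vertices are the last k of Fin (n + k)).
addIsolated : ∀ {n} → Graph n → (k : ℕ) → Fin (n + k) → Fin (n + k) → Bool
addIsolated {n} G k x y with splitAt n x | splitAt n y
... | inj₁ i | inj₁ j = adj G i j
... | _      | _      = false

IsCompetitionGraph : ∀ {m} → Digraph m → (Fin m → Fin m → Bool) → Set
IsCompetitionGraph {m} D H =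
  ∀ x y → x ≢ y → (T (H x y) ⇔ (∃[ z ] (Arc D x z × Arc D y z)))

Witness : ∀ {n} → Graph n → (k : ℕ) → Digraph (n + k) → Set
Witness G k D = Acyclic D × IsCompetitionGraph D (addIsolated G k)

IsCompetitionNumber : ∀ {n} → Graph n → ℕ → Set
IsCompetitionNumber G K =
  (∃[ D ] Witness G K D) × (∀ k (D : Digraph (_ + k)) → Witness G k D → K ≤ k)

InDeg0 : ∀ {m} → Digraph m → Fin m → Set
InDeg0 D v = ∀ u → arc D u v ≡ false

numSources : ∀ {m} → Digraph m → ℕ
numSources {m} D = length (filter (λ v → all? (λ u → arc D u v ≟ false)) (allFin m))

IsPrimaryPredatorIndex : ∀ {n} → Graph n → ℕ → Set
IsPrimaryPredatorIndex {n} G P =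
  Σ ℕ λ K → IsCompetitionNumber G K ×
    (∃[ D ] (Witness G K D × numSources D ≡ P)) ×
    (∀ (D : Digraph (n + K)) → Witness G K D → numSources D ≤ P)

IsClique : ∀ {n} → Graph n → Subset n → Set
IsClique G S = ∀ x y → x ∈ S → y ∈ S → x ≢ y → Edge G x y

IsMaximalClique : ∀ {n} → Graph n → Subset n → Set
IsMaximalClique G S = IsClique G S × (∀ S′ → IsClique G S′ → S ⊆ S′ → S′ ⊆ S)

Covers : ∀ {n} → Subset n → Fin n → Fin n → Set
Covers S x y = x ∈ S × y ∈ S

Occupied : ∀ {n} → Graph n → Subset n → Fin n → Fin n → Set
Occupied G C x y =
  Edge G x y × Covers C x y × (∀ C′ → IsMaximalClique G C′ → Covers C′ x y → C′ ≡ C)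

IsEdgeCliqueCover : ∀ {n} → Graph n → (t : ℕ) → (Fin t → Subset n) → Set
IsEdgeCliqueCover G t F =
  (∀ i → IsClique G (F i)) × (∀ x y → Edge G x y → ∃[ i ] Covers (F i) x y)

IsEdgeCliqueCoverNumber : ∀ {n} → Graph n → ℕ → Set
IsEdgeCliqueCoverNumber {n} G θ =
  (∃[ F ] IsEdgeCliqueCover G θ F) × (∀ t (F : Fin t → Subset n) → IsEdgeCliqueCover G t F → θ ≤ t)

module Submission where

-- Let K = k(G) and let D be an acyclic digraph with C(D) = G ∪ I_K
-- having the maximum number p = p(G) of sources; let t be the number of
-- non-sources of D, so that p + t = n + K.  We show t = θ_e(G), which gives
-- k(G) = θ_e(G) - n + p.
--   * θ_e ≤ t holds for every such D: the in-neighbourhoods of the non-sources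
--     are cliques of G covering every edge.
--   * t ≤ θ_e uses the maximality of p.  Deleting the arcs into a vertex, or
--     redirecting the arcs into one vertex to another, keeps D acyclic and keeps
--     C(D) under suitable conditions while creating a new source; so for our D,
--     in-neighbours of non-sources lie in G and two distinct non-sources never
--     have all their in-neighbours inside one clique.  Hence extending each
--     in-neighbourhood to a maximal clique is injective on non-sources, and a
--     family of distinct maximal cliques, each owning an occupied edge, is never
--     larger than an edge clique cover.

open import Defs hiding (sym)
open import Data.Nat as ℕ using (ℕ; suc; _≤_; _<_; s≤s; z≤n)
open import Data.Nat.Properties using (≤-antisym; <⇒≱; m≤n⇒m≤1+n; +-suc)
open import Data.Integer using (ℤ; +_; _+_; _-_)
open import Data.Integer.Properties using (pos-+)
open import Data.Integer.Tactic.RingSolver using (solve-∀)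
open import Data.Fin using (Fin; zero; suc; _↑ˡ_; splitAt) renaming (_≟_ to _≟F_)
open import Data.Fin.Properties using (all?; splitAt⁻¹-↑ˡ; splitAt-↑ˡ; ↑ˡ-injective; injective⇒≤)
open import Data.Fin.Subset using (Subset; _∈_; _⊆_; _∪_; ⁅_⁆)
open import Data.Fin.Subset.Properties using (_∈?_; x∈p∪q⁺; x∈p∪q⁻; x∈⁅x⁆; x∈⁅y⁆⇒x≡y; p⊆p∪q)
open import Data.Bool using (Bool; true; false; T; _∨_) renaming (_≟_ to _≟B_)
open import Data.Bool.Properties using (T?; T-∨; T-≡)
open import Data.Unit using (tt)
open import Data.Empty using (⊥; ⊥-elim)
open import Data.Sum using (_⊎_; inj₁; inj₂; swap)
open import Data.Product using (∃-syntax; _×_; _,_; proj₁; proj₂)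
open import Data.List using (List; []; _∷_; filter; length; allFin; lookup)
open import Data.List.Properties using (length-tabulate)
open import Data.List.Membership.Propositional using () renaming (_∈_ to _∈ₗ_)
open import Data.List.Membership.Propositional.Properties using (∈-allFin; ∈-filter⁺; ∈-filter⁻; ∈-lookup)
open import Data.List.Relation.Unary.Any using (here; there; index)
open import Data.List.Relation.Unary.Any.Properties using (lookup-index)
open import Data.List.Relation.Unary.All using () renaming (lookup to lookupAll)
open import Data.List.Relation.Unary.AllPairs using (_∷_)
open import Data.List.Relation.Unary.Unique.Propositional using (Unique)
open import Data.List.Relation.Unary.Unique.Propositional.Properties using (allFin⁺; filter⁺)
open import Data.Vec using (tabulate)
open import Data.Vec.Properties using (lookup∘tabulate; []=⇒lookup; lookup⇒[]=)
open import Function using (_∘_; case_of_)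
open import Function.Bundles using (mk⇔; Equivalence)
open import Function.Definitions using (Injective)
open import Relation.Nullary using (¬_; Dec; yes; no; ¬?)
open import Relation.Nullary.Decidable using (_→-dec_; ¬¬-excluded-middle)
open import Relation.Unary using (Pred; Decidable)
open import Relation.Unary.Properties using (∁?)
open import Relation.Binary.PropositionalEquality
  using (_≡_; _≢_; refl; sym; trans; cong; cong₂; subst; module ≡-Reasoning)
open import Relation.Binary.Construct.Closure.Transitive using (TransClosure; [_]; _∷_; _++_)

false⇒¬T : ∀ {b} → b ≡ false → ¬ T b
false⇒¬T refl ()

¬T⇒false : ∀ {b} → ¬ T b → b ≡ false
¬T⇒false {false} _  = refl
¬T⇒false {true}  ¬t = ⊥-elim (¬t tt)

-- This is how "D′ has more
-- sources than D" is turned into a comparison of the counts `numSources`.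
module _ {a p q} {A : Set a} {P : Pred A p} {Q : Pred A q}
         (P? : Decidable P) (Q? : Decidable Q) (P⇒Q : ∀ {x} → P x → Q x) where

  length-filter-mono : ∀ xs → length (filter P? xs) ≤ length (filter Q? xs)
  length-filter-mono [] = z≤n
  length-filter-mono (x ∷ xs) with P? x | Q? x
  ... | yes _  | yes _  = s≤s (length-filter-mono xs)
  ... | yes px | no ¬qx = ⊥-elim (¬qx (P⇒Q px))
  ... | no _   | yes _  = m≤n⇒m≤1+n (length-filter-mono xs)
  ... | no _   | no _   = length-filter-mono xs

  length-filter-strict : ∀ {xs y} → y ∈ₗ xs → Q y → ¬ P y →
                         length (filter P? xs) < length (filter Q? xs)
  length-filter-strict {x ∷ xs} (here refl) qx ¬px with P? x | Q? x
  ... | yes px | _      = ⊥-elim (¬px px)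
  ... | no _   | yes _  = s≤s (length-filter-mono xs)
  ... | no _   | no ¬qx = ⊥-elim (¬qx qx)
  length-filter-strict {x ∷ xs} (there y∈xs) qy ¬py with P? x | Q? x
  ... | yes _  | yes _  = s≤s (length-filter-strict y∈xs qy ¬py)
  ... | yes px | no ¬qx = ⊥-elim (¬qx (P⇒Q px))
  ... | no _   | yes _  = m≤n⇒m≤1+n (length-filter-strict y∈xs qy ¬py)
  ... | no _   | no _   = length-filter-strict y∈xs qy ¬py

length-filter-∁ : ∀ {a p} {A : Set a} {P : Pred A p} (P? : Decidable P) xs →
                  length (filter P? xs) ℕ.+ length (filter (∁? P?) xs) ≡ length xs
length-filter-∁ P? [] = refl
length-filter-∁ P? (x ∷ xs) with P? x
... | yes _ = cong suc (length-filter-∁ P? xs)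
... | no _  = trans (+-suc (length (filter P? xs)) (length (filter (∁? P?) xs)))
                    (cong suc (length-filter-∁ P? xs))

lookup-injective : ∀ {a} {A : Set a} {xs : List A} → Unique xs → Injective _≡_ _≡_ (lookup xs)
lookup-injective (_ ∷ _)   {zero}  {zero}  _ = refl
lookup-injective (x∉ ∷ _)  {zero}  {suc j} e = ⊥-elim (lookupAll x∉ (∈-lookup j) e)
lookup-injective (x∉ ∷ _)  {suc i} {zero}  e = ⊥-elim (lookupAll x∉ (∈-lookup i) (sym e))
lookup-injective (_ ∷ xs!) {suc i} {suc j} e = cong suc (lookup-injective xs! e)

module Enumeration {m p} {P : Pred (Fin m) p} (P? : Decidable P) where

  members : List (Fin m)
  members = filter P? (allFin m)

  size : ℕ
  size = length members

  element : Fin size → Fin m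
  element = lookup members

  element-satisfies : ∀ i → P (element i)
  element-satisfies i = proj₂ (∈-filter⁻ P? {xs = allFin m} (∈-lookup i))

  element-injective : Injective _≡_ _≡_ element
  element-injective = lookup-injective (filter⁺ P? (allFin⁺ m))

  element-onto : ∀ {v} → P v → ∃[ i ] v ≡ element i
  element-onto {v} pv = index v∈ , lookup-index v∈
    where
    v∈ : v ∈ₗ members
    v∈ = ∈-filter⁺ P? (∈-allFin v) pv

module MaximalCliques {n} (G : Graph n) where

  clique? : (S : Subset n) → Dec (IsClique G S)
  clique? S = all? λ x → all? λ y →
    x ∈? S →-dec y ∈? S →-dec ¬? (x ≟F y) →-dec T? (adj G x y)

  sub-clique : ∀ {S S′} → IsClique G S′ → S ⊆ S′ → IsClique G S
  sub-clique c S⊆S′ x y x∈ y∈ = c x y (S⊆S′ x∈) (S⊆S′ y∈)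

  grow : Subset n → Fin n → Subset n
  grow S v with clique? (S ∪ ⁅ v ⁆)
  ... | yes _ = S ∪ ⁅ v ⁆
  ... | no _  = S

  grow-⊇ : ∀ S v → S ⊆ grow S v
  grow-⊇ S v with clique? (S ∪ ⁅ v ⁆)
  ... | yes _ = p⊆p∪q ⁅ v ⁆
  ... | no _  = λ x∈ → x∈

  grow-clique : ∀ S v → IsClique G S → IsClique G (grow S v)
  grow-clique S v c with clique? (S ∪ ⁅ v ⁆)
  ... | yes c′ = c′
  ... | no _   = c

  grow-takes : ∀ S v S′ → IsClique G S′ → grow S v ⊆ S′ → v ∈ S′ → v ∈ grow S v
  grow-takes S v S′ c′ grow⊆S′ v∈S′ with clique? (S ∪ ⁅ v ⁆)
  ... | yes _ = x∈p∪q⁺ (inj₂ (x∈⁅x⁆ v))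
  ... | no ¬c = ⊥-elim (¬c (sub-clique c′ S∪v⊆S′))
    where
    S∪v⊆S′ : S ∪ ⁅ v ⁆ ⊆ S′
    S∪v⊆S′ {x} x∈ with x∈p∪q⁻ S ⁅ v ⁆ x∈
    ... | inj₁ x∈S = grow⊆S′ x∈S
    ... | inj₂ x≡v = subst (_∈ S′) (sym (x∈⁅y⁆⇒x≡y v x≡v)) v∈S′

  growAll : Subset n → List (Fin n) → Subset n
  growAll S []       = S
  growAll S (v ∷ vs) = growAll (grow S v) vs

  growAll-⊇ : ∀ S vs → S ⊆ growAll S vs
  growAll-⊇ S []       x∈ = x∈
  growAll-⊇ S (v ∷ vs) x∈ = growAll-⊇ (grow S v) vs (grow-⊇ S v x∈)

  growAll-clique : ∀ S vs → IsClique G S → IsClique G (growAll S vs)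
  growAll-clique S []       c = c
  growAll-clique S (v ∷ vs) c = growAll-clique (grow S v) vs (grow-clique S v c)

  growAll-takes : ∀ S vs S′ → IsClique G S′ → growAll S vs ⊆ S′ →
                  ∀ {v} → v ∈ₗ vs → v ∈ S′ → v ∈ growAll S vs
  growAll-takes S (v ∷ vs) S′ c′ ⊆S′ (here refl) v∈S′ =
    growAll-⊇ (grow S v) vs (grow-takes S v S′ c′ (⊆S′ ∘ growAll-⊇ (grow S v) vs) v∈S′)
  growAll-takes S (u ∷ vs) S′ c′ ⊆S′ (there v∈vs) v∈S′ =
    growAll-takes (grow S u) vs S′ c′ ⊆S′ v∈vs v∈S′

  maximalExtension : Subset n → Subset n
  maximalExtension S = growAll S (allFin n)

  maximalExtension-⊇ : ∀ S → S ⊆ maximalExtension S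
  maximalExtension-⊇ S = growAll-⊇ S (allFin n)

  maximalExtension-maximal : ∀ S → IsClique G S → IsMaximalClique G (maximalExtension S)
  maximalExtension-maximal S c =
    growAll-clique S (allFin n) c ,
    λ S′ c′ ⊆S′ {v} → growAll-takes S (allFin n) S′ c′ ⊆S′ (∈-allFin v)

  -- If every maximal clique occupies an edge, distinct maximal cliques are at most
  -- as many as the cliques of any edge clique cover: send a maximal clique to a
  -- cover clique containing its occupied edge; that cover clique extends to a
  -- maximal clique covering the edge, which must be the original one.
  distinctMaximalCliques≤cover :
    (∀ C → IsMaximalClique G C → ∃[ x ] ∃[ y ] Occupied G C x y) →
    ∀ {t θ} (C : Fin t → Subset n) → (∀ i → IsMaximalClique G (C i)) → Injective _≡_ _≡_ C →
    (F : Fin θ → Subset n) → IsEdgeCliqueCover G θ F → t ≤ θ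
  distinctMaximalCliques≤cover occupied C C-max C-inj F (F-clique , F-covers) =
    injective⇒≤ {f = proj₁ ∘ owner} owner-injective
    where
    owner : ∀ i → ∃[ l ] maximalExtension (F l) ≡ C i
    owner i with occupied (C i) (C-max i)
    ... | x , y , xy , _ , unique with F-covers x y xy
    ...   | l , x∈ , y∈ = l , unique (maximalExtension (F l)) (maximalExtension-maximal (F l) (F-clique l))
                                     (maximalExtension-⊇ (F l) x∈ , maximalExtension-⊇ (F l) y∈)

    owner-injective : Injective _≡_ _≡_ (proj₁ ∘ owner)
    owner-injective {i} {j} same = C-inj (begin
      C i                                    ≡⟨ sym (proj₂ (owner i)) ⟩
      maximalExtension (F (proj₁ (owner i))) ≡⟨ cong (maximalExtension ∘ F) same ⟩
      maximalExtension (F (proj₁ (owner j))) ≡⟨ proj₂ (owner j) ⟩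
      C j                                    ∎)
      where open ≡-Reasoning

Reach : ∀ {m} → Digraph m → Fin m → Fin m → Set
Reach D = TransClosure (Arc D)

reach-mono : ∀ {m} {D D′ : Digraph m} → (∀ {u v} → Arc D′ u v → Arc D u v) →
             ∀ {x y} → Reach D′ x y → Reach D x y
reach-mono D′⊆D [ a ]     = [ D′⊆D a ]
reach-mono {D = D} {D′} D′⊆D (a ∷ as) = D′⊆D a ∷ reach-mono {D = D} {D′} D′⊆D as

module DeleteInArcs {m} (D : Digraph m) (s : Fin m) where

  arc′ : Fin m → Fin m → Bool
  arc′ u v with v ≟F s
  ... | yes _ = false
  ... | no _  = arc D u v

  arc′-view : ∀ {u v} → T (arc′ u v) → v ≢ s × Arc D u v
  arc′-view {u} {v} a with v ≟F s
  ... | no v≢s = v≢s , a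

  arc′-keeps : ∀ {u v} → v ≢ s → Arc D u v → T (arc′ u v)
  arc′-keeps {u} {v} v≢s a with v ≟F s
  ... | yes v≡s = ⊥-elim (v≢s v≡s)
  ... | no _    = a

  D′ : Digraph m
  D′ = record { arc = arc′ ; noLoop = λ v → ¬T⇒false (false⇒¬T (noLoop D v) ∘ proj₂ ∘ arc′-view) }

  acyclic : Acyclic D → Acyclic D′
  acyclic ac x = ac x ∘ reach-mono {D = D} {D′} (proj₂ ∘ arc′-view)

  competition : ∀ {H} → IsCompetitionGraph D H →
                (∀ x y → Arc D x s → Arc D y s → x ≢ y → ⊥) → IsCompetitionGraph D′ H
  competition {H} cg noEdgeAt-s x y x≢y = mk⇔ to from
    where
    to : T (H x y) → ∃[ z ] (Arc D′ x z × Arc D′ y z)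
    to h with Equivalence.to (cg x y x≢y) h
    ... | z , xz , yz with z ≟F s
    ...   | yes refl = ⊥-elim (noEdgeAt-s x y xz yz x≢y)
    ...   | no z≢s   = z , arc′-keeps z≢s xz , arc′-keeps z≢s yz
    from : ∃[ z ] (Arc D′ x z × Arc D′ y z) → T (H x y)
    from (z , xz , yz) = Equivalence.from (cg x y x≢y) (z , proj₂ (arc′-view xz) , proj₂ (arc′-view yz))

  sources-kept : ∀ v → InDeg0 D v → InDeg0 D′ v
  sources-kept v v-src u = ¬T⇒false (false⇒¬T (v-src u) ∘ proj₂ ∘ arc′-view)

  s-source : InDeg0 D′ s
  s-source u with s ≟F s
  ... | yes _   = refl
  ... | no s≢s = ⊥-elim (s≢s refl)

module Redirect {m} (D : Digraph m) (s w : Fin m) (w≢s : w ≢ s) (¬w⇝s : ¬ Reach D w s) where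

  arc′ : Fin m → Fin m → Bool
  arc′ u v with v ≟F s | v ≟F w
  ... | yes _ | _     = false
  ... | no _  | yes _ = arc D u s ∨ arc D u w
  ... | no _  | no _  = arc D u v

  arc′-view : ∀ {u v} → T (arc′ u v) → (v ≢ s × Arc D u v) ⊎ (v ≡ w × Arc D u s)
  arc′-view {u} {v} a with v ≟F s | v ≟F w
  ... | no v≢s | no _    = inj₁ (v≢s , a)
  ... | no v≢s | yes refl with Equivalence.to T-∨ a
  ...   | inj₁ us = inj₂ (refl , us)
  ...   | inj₂ uw = inj₁ (v≢s , uw)

  arc′-redirected : ∀ {u} → Arc D u s → T (arc′ u w)
  arc′-redirected a with w ≟F s | w ≟F w
  ... | yes w≡s | _      = ⊥-elim (w≢s w≡s)
  ... | no _    | yes _  = Equivalence.from T-∨ (inj₁ a)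
  ... | no _    | no w≢w = ⊥-elim (w≢w refl)

  arc′-keeps : ∀ {u v} → v ≢ s → Arc D u v → T (arc′ u v)
  arc′-keeps {u} {v} v≢s a with v ≟F s | v ≟F w
  ... | yes v≡s | _     = ⊥-elim (v≢s v≡s)
  ... | no _    | yes refl = Equivalence.from T-∨ (inj₂ a)
  ... | no _    | no _  = a

  -- a loop at w would come from an arc w → s, a walk from w to s
  noLoop′ : ∀ v → arc′ v v ≡ false
  noLoop′ v = ¬T⇒false λ a → case arc′-view a of λ
    { (inj₁ (_ , vv))    → false⇒¬T (noLoop D v) vv
    ; (inj₂ (refl , ws)) → ¬w⇝s [ ws ] }

  D′ : Digraph m
  D′ = record { arc = arc′ ; noLoop = noLoop′ }

  reach′-view : ∀ {a b} → Reach D′ a b → Reach D a b ⊎ (Reach D a s × (b ≡ w ⊎ Reach D w b))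
  reach′-view [ ab ] with arc′-view ab
  ... | inj₁ (_ , ab₀)    = inj₁ [ ab₀ ]
  ... | inj₂ (b≡w , as₀) = inj₂ ([ as₀ ] , inj₁ b≡w)
  reach′-view (ac ∷ cb) with arc′-view ac | reach′-view cb
  ... | inj₁ (_ , ac₀)     | inj₁ cb₀            = inj₁ (ac₀ ∷ cb₀)
  ... | inj₁ (_ , ac₀)     | inj₂ (cs₀ , rest)   = inj₂ (ac₀ ∷ cs₀ , rest)
  ... | inj₂ (refl , as₀) | inj₁ wb₀            = inj₂ ([ as₀ ] , inj₂ wb₀)
  ... | inj₂ (refl , _)   | inj₂ (ws₀ , _)      = ⊥-elim (¬w⇝s ws₀)

  acyclic : Acyclic D → Acyclic D′
  acyclic ac a cycle with reach′-view cycle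
  ... | inj₁ aa               = ac a aa
  ... | inj₂ (as , inj₁ refl) = ¬w⇝s as
  ... | inj₂ (as , inj₂ wa)   = ¬w⇝s (wa ++ as)

  InNbr : Fin m → Set
  InNbr x = Arc D x s ⊎ Arc D x w

  competition : ∀ {H} → IsCompetitionGraph D H →
                (∀ x y → InNbr x → InNbr y → x ≢ y → T (H x y)) → IsCompetitionGraph D′ H
  competition {H} cg clique x y x≢y = mk⇔ to from
    where
    to : T (H x y) → ∃[ z ] (Arc D′ x z × Arc D′ y z)
    to h with Equivalence.to (cg x y x≢y) h
    ... | z , xz , yz with z ≟F s
    ...   | yes refl = w , arc′-redirected xz , arc′-redirected yz
    ...   | no z≢s   = z , arc′-keeps z≢s xz , arc′-keeps z≢s yz
    from : ∃[ z ] (Arc D′ x z × Arc D′ y z) → T (H x y)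
    from (z , xz , yz) with arc′-view xz | arc′-view yz
    ... | inj₁ (_ , xz₀)    | inj₁ (_ , yz₀)    = Equivalence.from (cg x y x≢y) (z , xz₀ , yz₀)
    ... | inj₂ (_ , xs₀)    | inj₂ (_ , ys₀)    = Equivalence.from (cg x y x≢y) (s , xs₀ , ys₀)
    ... | inj₂ (refl , xs₀) | inj₁ (_ , yw₀)    = clique x y (inj₁ xs₀) (inj₂ yw₀) x≢y
    ... | inj₁ (_ , xw₀)    | inj₂ (refl , ys₀) = clique x y (inj₂ xw₀) (inj₁ ys₀) x≢y

  sources-kept : ¬ InDeg0 D w → ∀ v → InDeg0 D v → InDeg0 D′ v
  sources-kept ¬w-src v v-src u = ¬T⇒false λ a → case arc′-view a of λ
    { (inj₁ (_ , uv))   → false⇒¬T (v-src u) uv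
    ; (inj₂ (refl , _)) → ¬w-src v-src }

  s-source : InDeg0 D′ s
  s-source u with s ≟F s
  ... | yes _   = refl
  ... | no s≢s = ⊥-elim (s≢s refl)

-- Facts about digraphs D with C(D) = G ∪ I_K; the vertices of G are x ↑ˡ K.
module Witnesses {n} (G : Graph n) (K : ℕ) where

  N : ℕ
  N = n ℕ.+ K

  H : Fin N → Fin N → Bool
  H = addIsolated G K

  H-old : ∀ x y → H (x ↑ˡ K) (y ↑ˡ K) ≡ adj G x y
  H-old x y rewrite splitAt-↑ˡ n x K | splitAt-↑ˡ n y K = refl

  H-new : ∀ {x j} → splitAt n x ≡ inj₂ j → ∀ y → H x y ≡ false
  H-new eq y rewrite eq = refl

  module _ (D : Digraph N) where

    inNbr : Fin N → Subset n
    inNbr w = tabulate (λ x → arc D (x ↑ˡ K) w)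

    inNbr⇒arc : ∀ {w x} → x ∈ inNbr w → Arc D (x ↑ˡ K) w
    inNbr⇒arc {w} {x} x∈ = Equivalence.from T-≡
      (trans (sym (lookup∘tabulate (λ x → arc D (x ↑ˡ K) w) x)) ([]=⇒lookup x∈))

    arc⇒inNbr : ∀ {w x} → Arc D (x ↑ˡ K) w → x ∈ inNbr w
    arc⇒inNbr {w} {x} a = lookup⇒[]= x (inNbr w)
      (trans (lookup∘tabulate (λ x → arc D (x ↑ˡ K) w) x) (Equivalence.to T-≡ a))

    source? : Decidable (InDeg0 D)
    source? v = all? (λ u → arc D u v ≟B false)

    open Enumeration (∁? source?) public
      renaming (size to nonSourceCount; element to nonSource; element-satisfies to nonSource-notSource;
                element-injective to nonSource-injective; element-onto to nonSource-onto)

    sources+nonSources : numSources D ℕ.+ nonSourceCount ≡ N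
    sources+nonSources = trans (length-filter-∁ source? (allFin N)) (length-tabulate {A = Fin N} (λ x → x))

    module _ (cg : IsCompetitionGraph D H) where

      inNbr-clique : ∀ w → IsClique G (inNbr w)
      inNbr-clique w x y x∈ y∈ x≢y = subst T (H-old x y)
        (Equivalence.from (cg (x ↑ˡ K) (y ↑ˡ K) (x≢y ∘ ↑ˡ-injective K x y)) (w , inNbr⇒arc x∈ , inNbr⇒arc y∈))

      -- θ_e(G) ≤ number of non-sources: every edge of G has a common prey, which
      -- is not a source
      nonSource-cover : IsEdgeCliqueCover G nonSourceCount (inNbr ∘ nonSource)
      nonSource-cover = inNbr-clique ∘ nonSource , covers
        where
        covers : ∀ x y → Edge G x y → ∃[ i ] Covers (inNbr (nonSource i)) x y
        covers x y xy with Equivalence.to (cg (x ↑ˡ K) (y ↑ˡ K) x↑≢y↑) (subst T (sym (H-old x y)) xy)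
          where
          x↑≢y↑ : x ↑ˡ K ≢ y ↑ˡ K
          x↑≢y↑ eq = false⇒¬T (irrefl G y) (subst (λ z → Edge G z y) (↑ˡ-injective K x y eq) xy)
        ... | z , xz , yz with nonSource-onto {z} (λ z-src → false⇒¬T (z-src (x ↑ˡ K)) xz)
        ...   | i , refl = i , arc⇒inNbr xz , arc⇒inNbr yz

  module SourceMaximal (D : Digraph N) (W : Witness G K D)
           (maxSources : ∀ D′ → Witness G K D′ → numSources D′ ≤ numSources D) where

    open MaximalCliques G

    no-extra-source : ∀ D′ → Witness G K D′ → (∀ v → InDeg0 D v → InDeg0 D′ v) →
                      ∀ s → InDeg0 D′ s → ¬ InDeg0 D s → ⊥
    no-extra-source D′ W′ more s s-src′ ¬s-src =
      <⇒≱ (length-filter-strict (source? D) (source? D′) (more _) (∈-allFin s) s-src′ ¬s-src)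
          (maxSources D′ W′)

    -- A new vertex x has no neighbours, so if x preys on w then x is the only
    -- in-neighbour of w, and deleting the arcs into w would create a source.
    inNbr-old : ∀ {w x} → ¬ InDeg0 D w → Arc D x w → ∃[ x′ ] x′ ↑ˡ K ≡ x
    inNbr-old {w} {x} ¬w-src xw with splitAt n x in eq
    ... | inj₁ x′ = x′ , splitAt⁻¹-↑ˡ eq
    ... | inj₂ j  = ⊥-elim (no-extra-source D′ (acyclic (proj₁ W) , competition (proj₂ W) alone)
                                            sources-kept w s-source ¬w-src)
      where
      open DeleteInArcs D w
      only-x : ∀ {c} → Arc D c w → c ≡ x
      only-x {c} cw with c ≟F x
      ... | yes c≡x = c≡x
      ... | no c≢x  = ⊥-elim (false⇒¬T (H-new eq c)
                               (Equivalence.from (proj₂ W x c (c≢x ∘ sym)) (w , xw , cw)))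
      alone : ∀ a b → Arc D a w → Arc D b w → a ≢ b → ⊥
      alone a b aw bw a≢b = a≢b (trans (only-x aw) (sym (only-x bw)))

    -- Redirecting the arcs into a non-source s to a non-source w not reaching s
    -- would create a source, so their in-neighbours are not pairwise adjacent.
    no-redirect : ∀ s w → ¬ InDeg0 D s → ¬ InDeg0 D w → (w≢s : w ≢ s) → (¬w⇝s : ¬ Reach D w s) →
                  ¬ (∀ x y → Redirect.InNbr D s w w≢s ¬w⇝s x → Redirect.InNbr D s w w≢s ¬w⇝s y →
                             x ≢ y → T (H x y))
    no-redirect s w ¬s-src ¬w-src w≢s ¬w⇝s clique =
      no-extra-source D′ (acyclic (proj₁ W) , competition (proj₂ W) clique)
                      (sources-kept ¬w-src) s s-source ¬s-src
      where open Redirect D s w w≢s ¬w⇝s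

    -- Distinct non-sources never have all their in-neighbours pairwise adjacent:
    -- by acyclicity one of them does not reach the other, so redirection applies.
    no-shared-clique : ∀ {w w′} → ¬ InDeg0 D w → ¬ InDeg0 D w′ → w ≢ w′ →
                       ¬ (∀ x y → Arc D x w ⊎ Arc D x w′ → Arc D y w ⊎ Arc D y w′ → x ≢ y → T (H x y))
    no-shared-clique {w} {w′} ¬w-src ¬w′-src w≢w′ clique = ¬¬-excluded-middle λ
      { (yes w⇝w′) → no-redirect w w′ ¬w-src ¬w′-src (w≢w′ ∘ sym) (λ w′⇝w → proj₁ W w (w⇝w′ ++ w′⇝w)) clique
      ; (no ¬w⇝w′) → no-redirect w′ w ¬w′-src ¬w-src w≢w′ ¬w⇝w′
                       (λ x y ix iy → clique x y (swap ix) (swap iy)) }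

    preyClique : Fin N → Subset n
    preyClique w = maximalExtension (inNbr D w)

    preyClique-maximal : ∀ w → IsMaximalClique G (preyClique w)
    preyClique-maximal w = maximalExtension-maximal (inNbr D w) (inNbr-clique D (proj₂ W) w)

    -- Distinct non-sources have distinct prey cliques: otherwise all their
    -- in-neighbours (which lie in G) would lie in one clique.
    preyClique-injective : ∀ {w w′} → ¬ InDeg0 D w → ¬ InDeg0 D w′ → preyClique w ≡ preyClique w′ → w ≡ w′
    preyClique-injective {w} {w′} ¬w-src ¬w′-src same with w ≟F w′
    ... | yes w≡w′ = w≡w′
    ... | no w≢w′  = ⊥-elim (no-shared-clique ¬w-src ¬w′-src w≢w′ adjacent)
      where
      inPreyClique : ∀ {x} → Arc D x w ⊎ Arc D x w′ → ∃[ x′ ] (x′ ↑ˡ K ≡ x × x′ ∈ preyClique w)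
      inPreyClique (inj₁ xw) with inNbr-old ¬w-src xw
      ... | x′ , refl = x′ , refl , maximalExtension-⊇ (inNbr D w) (arc⇒inNbr D xw)
      inPreyClique (inj₂ xw′) with inNbr-old ¬w′-src xw′
      ... | x′ , refl = x′ , refl , subst (x′ ∈_) (sym same) (maximalExtension-⊇ (inNbr D w′) (arc⇒inNbr D xw′))

      adjacent : ∀ x y → Arc D x w ⊎ Arc D x w′ → Arc D y w ⊎ Arc D y w′ → x ≢ y → T (H x y)
      adjacent x y ix iy x≢y with inPreyClique ix | inPreyClique iy
      ... | x′ , refl , x′∈ | y′ , refl , y′∈ = subst T (sym (H-old x′ y′))
        (proj₁ (preyClique-maximal w) x′ y′ x′∈ y′∈ (x≢y ∘ cong (_↑ˡ K)))

    nonSources≤cover : (∀ C → IsMaximalClique G C → ∃[ x ] ∃[ y ] Occupied G C x y) →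
                       ∀ {θ} (F : Fin θ → Subset n) → IsEdgeCliqueCover G θ F → nonSourceCount D ≤ θ
    nonSources≤cover occupied =
      distinctMaximalCliques≤cover occupied (preyClique ∘ nonSource D) (preyClique-maximal ∘ nonSource D)
        (λ {i} {j} same → nonSource-injective D
          (preyClique-injective (nonSource-notSource D i) (nonSource-notSource D j) same))

rearrange : ∀ k p θ n → p ℕ.+ θ ≡ n ℕ.+ k → + k ≡ (+ θ - + n) + + p
rearrange k p θ n eq = begin
  + k                 ≡⟨ cancel (+ n) (+ k) ⟩
  (+ n + + k) - + n   ≡⟨ cong (_- + n) (sym (pos-+ n k)) ⟩
  + (n ℕ.+ k) - + n   ≡⟨ cong (λ z → + z - + n) (sym eq) ⟩
  + (p ℕ.+ θ) - + n   ≡⟨ cong (_- + n) (pos-+ p θ) ⟩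
  (+ p + + θ) - + n   ≡⟨ regroup (+ p) (+ θ) (+ n) ⟩
  (+ θ - + n) + + p   ∎
  where
  open ≡-Reasoning
  cancel : ∀ (a b : ℤ) → b ≡ (a + b) - a
  cancel = solve-∀
  regroup : ∀ (a b c : ℤ) → (a + b) - c ≡ (b - c) + a
  regroup = solve-∀

-- Take a witness D for k(G) with
-- p(G) sources; its non-sources number exactly θ_e(G), and sources plus
-- non-sources make up the n + k(G) vertices.  (The argument does not need the
-- hypothesis that G has an edge.)
proposition3p7 : ∀ {n} (G : Graph n) →
    (∃[ x ] ∃[ y ] Edge G x y) →
    (∀ C → IsMaximalClique G C → ∃[ x ] ∃[ y ] Occupied G C x y) →
    ∀ k p θ → IsCompetitionNumber G k → IsPrimaryPredatorIndex G p →
      IsEdgeCliqueCoverNumber G θ →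
      + k ≡ (+ θ - + n) + + p
proposition3p7 {n} G _ occupied k p θ ((Dₖ , Wₖ) , k-least) (K , ((D_K , W_K) , K-least) , (D , W , sources≡p) , maxSources)
               ((F , F-cover) , θ-least) = rearrange k p θ n counting
  where
  open Witnesses G K
  open SourceMaximal D W (λ D′ W′ → subst (numSources D′ ≤_) (sym sources≡p) (maxSources D′ W′))

  K≡k : K ≡ k
  K≡k = ≤-antisym (K-least k Dₖ Wₖ) (k-least K D_K W_K)

  nonSources≡θ : nonSourceCount D ≡ θ
  nonSources≡θ = ≤-antisym (nonSources≤cover occupied F F-cover) (θ-least _ _ (nonSource-cover D (proj₂ W)))

  counting : p ℕ.+ θ ≡ n ℕ.+ k
  counting = begin
    p ℕ.+ θ                                ≡⟨ cong₂ ℕ._+_ (sym sources≡p) (sym nonSources≡θ) ⟩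
    numSources D ℕ.+ nonSourceCount D      ≡⟨ sources+nonSources D ⟩
    n ℕ.+ K                                ≡⟨ cong (n ℕ.+_) K≡k ⟩
    n ℕ.+ k                                ∎
    where open ≡-Reasoning
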